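{- Let $G$ be a context-free grammar with ownership, $A$ a nondeterministic finite automaton over its terminals, $\sigma$ the least solution of the system of equations induced by $G$ and $A$, and $\alpha$ a sentential form. Then $\mathcal{T}_\alpha\equiv\sigma(\alpha)$: for every assignment $\nu$ from boxes to $\{\mathit{true},\mathit{false}\}$, the value of the formula tree $\mathcal{T}_\alpha$ under $\nu$ equals the truth value of $\sigma(\alpha)$ under $\nu$.
   Context: Game: $G=(N_{\bigcirc}\,\dot\cup\,N_{\square},T,P)$ with disjoint finite sets of non-terminals $N=N_\bigcirc\cup N_\square$ (owned by refuter and prover, respectively) and terminals $T$, and finitely many rules $X\to\eta$ ($X\in N$, $\eta\in(N\cup T)^*$); every non-terminal has a rule. Left derivation: $wX\gamma\Rightarrow_L w\eta\gamma$ for $w\in T^*$ and a rule $X\to\eta$. A sentential form is owned by prover if its leftmost non-terminal is in $N_\square$, otherwise by refuter. Domain: $A=(T,Q,q_0,Q_F,\to)$. Boxes are subsets of $Q\times Q$, composed relationally ($\rho;\tau=\{(q,q''):\exists q'.(q,q')\in\rho,(q',q'')\in\tau\}$), $\mathrm{id}=\{(q,q)\}$, and for $w\in T^*$, $[w]=\{(q,q'):q\xrightarrow{w}q'\}$. $BF_A$ is the set of negation-free Boolean formulas over boxes with constant $\mathit{false}$ (simplified syntactically by $\mathit{false}\wedge F=\mathit{false}$, $\mathit{false}\vee F=F$ and symmetrically). Composition of formulas: $F;\mathit{false}=\mathit{false};G=\mathit{false}$, $(F_1\star F_2);G=(F_1;G)\star(F_2;G)$, $\rho;(G_1\star G_2)=(\rho;G_1)\star(\rho;G_2)$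 for $\star\in\{\wedge,\vee\}$, $\rho$ a box. Formulas are taken modulo logical equivalence and ordered by implication. The induced system has, for each non-terminal $X$ with rules $X\to\eta_1,\dots,X\to\eta_k$, the equation $\Delta_X=[\eta_1]\wedge\dots\wedge[\eta_k]$ if $X\in N_\square$ and $\Delta_X=[\eta_1]\vee\dots\vee[\eta_k]$ if $X\in N_\bigcirc$, where $[\varepsilon]=\mathrm{id}$, $[a]$ is the box of $a$, $[Y]=\Delta_Y$, $[\alpha\beta]=[\alpha];[\beta]$. $\sigma$ is its least solution (Kleene iteration from $\mathit{false}$), extended by $\sigma(\varepsilon)=\mathrm{id}$, $\sigma(a)=[a]$, $\sigma(\alpha\beta)=\sigma(\alpha);\sigma(\beta)$. Trees: $\mathcal{T}_\alpha$ is the tree of plays from $\alpha$: its root is labeled $\alpha$, the children of a node labeled $\beta$ are labeled by all $\beta'$ with $\beta\Rightarrow_L\beta'$; a node labeled by a terminal word $w$ is a leaf carrying the box $[w]$; an inner node is a $\wedge$-node if its sentential form is owned by prover and a $\vee$-node if owned by refuter. Given $\nu$, let $e_\nu$ be the set of leaves whose box $\nu$ maps to true; $p(e)$ adds to a node set $e$ all $\vee$-nodes with some child in $e$ and all $\wedge$-nodes with all children in $e$; the value of the tree under $\nu$ is true iff the root lies in $\bigcup_i p^i(e_\nu)$ (the empty tree has value false). -}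

module Defs where

open import Data.Nat using (ℕ; zero; suc)
open import Data.Fin using (Fin; _≟_)
import Data.Fin as Fin
open import Data.Bool using (Bool; true; false; _∧_; _∨_; if_then_else_)
open import Data.Vec using (Vec; tabulate; lookup)
open import Data.List using (List; []; _∷_; map; _++_)
open import Data.List.Membership.Propositional using (_∈_)
open import Data.Product using (Σ; _×_; _,_; proj₁)
open import Data.Sum using (_⊎_)
open import Data.Maybe using (Maybe; just; nothing)
open import Relation.Nullary.Decidable using (⌊_⌋)
open import Relation.Binary.PropositionalEquality using (_≡_)

data Owner : Set where
  prover refuter : Owner      -- prover owns N_□, refuter owns N_○

data Sym (m t : ℕ) : Set where
  nt : Fin m → Sym m t
  tm : Fin t → Sym m t

record Grammar : Set where
  field
    m     : ℕ
    t     : ℕ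
    owner : Fin m → Owner
    rules : List (Fin m × List (Sym m t))

record NFA (t : ℕ) : Set where
  field
    n     : ℕ
    q₀    : Fin n
    final : Fin n → Bool
    δ     : Fin n → Fin t → Fin n → Bool

-- Boxes: subsets of Q × Q, as Boolean matrices (canonical representation)

Box : ℕ → Set
Box n = Vec (Vec Bool n) n

entry : ∀ {n} → Box n → Fin n → Fin n → Bool
entry ρ q q' = lookup (lookup ρ q) q'

anyF : ∀ {n} → (Fin n → Bool) → Bool
anyF {zero}  f = false
anyF {suc n} f = f Fin.zero ∨ anyF (λ i → f (Fin.suc i))

_⨾ᵇ_ : ∀ {n} → Box n → Box n → Box n
ρ ⨾ᵇ τ = tabulate λ q → tabulate λ q'' → anyF λ q' → entry ρ q q' ∧ entry τ q' q''

idᵇ : ∀ {n} → Box n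
idᵇ = tabulate λ q → tabulate λ q' → ⌊ q ≟ q' ⌋

data BF (n : ℕ) : Set where
  atom : Box n → BF n
  ff   : BF n
  _∧ᶠ_ : BF n → BF n → BF n
  _∨ᶠ_ : BF n → BF n → BF n

eval : ∀ {n} → (Box n → Bool) → BF n → Bool
eval ν (atom ρ) = ν ρ
eval ν ff       = false
eval ν (F ∧ᶠ G) = eval ν F ∧ eval ν G
eval ν (F ∨ᶠ G) = eval ν F ∨ eval ν G

_≈ᶠ_ : ∀ {n} → BF n → BF n → Set
F ≈ᶠ G = ∀ ν → eval ν F ≡ eval ν G

_⊑ᶠ_ : ∀ {n} → BF n → BF n → Set
F ⊑ᶠ G = ∀ ν → eval ν F ≡ true → eval ν G ≡ true

_⊳_ : ∀ {n} → Box n → BF n → BF n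
ρ ⊳ atom τ   = atom (ρ ⨾ᵇ τ)
ρ ⊳ ff       = ff
ρ ⊳ (G ∧ᶠ H) = (ρ ⊳ G) ∧ᶠ (ρ ⊳ H)
ρ ⊳ (G ∨ᶠ H) = (ρ ⊳ G) ∨ᶠ (ρ ⊳ H)

_⨾ᶠ_ : ∀ {n} → BF n → BF n → BF n
atom ρ   ⨾ᶠ G = ρ ⊳ G
ff       ⨾ᶠ G = ff
(F ∧ᶠ H) ⨾ᶠ G = (F ⨾ᶠ G) ∧ᶠ (H ⨾ᶠ G)
(F ∨ᶠ H) ⨾ᶠ G = (F ⨾ᶠ G) ∨ᶠ (H ⨾ᶠ G)

big : ∀ {n} → Owner → List (BF n) → BF n
big o []                   = ff
big o (F ∷ [])             = F
big prover  (F ∷ G ∷ Fs)   = F ∧ᶠ big prover  (G ∷ Fs)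
big refuter (F ∷ G ∷ Fs)   = F ∨ᶠ big refuter (G ∷ Fs)

module Game (G : Grammar) (A : NFA (Grammar.t G)) where
  open Grammar G
  open NFA A

  SF : Set
  SF = List (Sym m t)

  letterBox : Fin t → Box n
  letterBox a = tabulate λ q → tabulate λ q' → δ q a q'

  wordBox : List (Fin t) → Box n
  wordBox []      = idᵇ
  wordBox (a ∷ w) = letterBox a ⨾ᵇ wordBox w

  symForm : (Fin m → BF n) → Sym m t → BF n
  symForm τ (nt X) = τ X
  symForm τ (tm a) = atom (letterBox a)

  form : (Fin m → BF n) → SF → BF n
  form τ []            = atom idᵇ
  form τ (s ∷ [])      = symForm τ s
  form τ (s ∷ s' ∷ α)  = symForm τ s ⨾ᶠ form τ (s' ∷ α)

  rhsOf : Fin m → List (Fin m × List (Sym m t)) → List SF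
  rhsOf X []              = []
  rhsOf X ((Y , η) ∷ rs)  = if ⌊ Y ≟ X ⌋ then η ∷ rhsOf X rs else rhsOf X rs

  Δ : (Fin m → BF n) → Fin m → BF n
  Δ τ X = big (owner X) (map (form τ) (rhsOf X rules))

  IsSolution : (Fin m → BF n) → Set
  IsSolution τ = ∀ X → τ X ≈ᶠ Δ τ X

  IsLeastSolution : (Fin m → BF n) → Set
  IsLeastSolution σ =
    IsSolution σ × (∀ τ → IsSolution τ → ∀ X → σ X ⊑ᶠ τ X)

  data _⇒L_ : SF → SF → Set where
    step : (w : List (Fin t)) (X : Fin m) (η γ : SF) → (X , η) ∈ rules →
           (map tm w ++ nt X ∷ γ) ⇒L (map tm w ++ η ++ γ)

  leftmost : SF → Maybe (Fin m)
  leftmost []         = nothing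
  leftmost (nt X ∷ α) = just X
  leftmost (tm a ∷ α) = leftmost α

  OwnedBy : Owner → SF → Set
  OwnedBy o α = Σ (Fin m) λ X → leftmost α ≡ just X × owner X ≡ o

  InE : (Box n → Bool) → SF → Set
  InE ν α = Σ (List (Fin t)) λ w → α ≡ map tm w × ν (wordBox w) ≡ true

  InP : (Box n → Bool) → ℕ → SF → Set
  InP ν zero    α = InE ν α
  InP ν (suc i) α =
    InP ν i α
    ⊎ (OwnedBy refuter α × Σ SF λ β → (α ⇒L β) × InP ν i β)
    ⊎ (OwnedBy prover α × (∀ β → α ⇒L β → InP ν i β))

  -- value of the tree 𝒯_α under ν: root ∈ ⋃_i p^i(e_ν)
  TreeValue : (Box n → Bool) → SF → Set
  TreeValue ν α = Σ ℕ λ i → InP ν i α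

module Submission where

-- Tree and formula obey the same one-step unfolding: a node w X γ owned by refuter (prover)
-- is won iff some (every) child w η γ is, and the formula of w X γ is Δ_X evaluated under
-- the valuation that the context w _ γ induces. Hence every node of the attractor
-- ⋃ pⁱ(e_ν) satisfies σ, by induction on i, because σ solves the equations.
-- Conversely, the Kleene iterates increase and, a formula being determined by its values
-- on the finitely many restrictions of valuations to the finitely many boxes, they become
-- stationary at some solution, which lies above σ since σ is least. A sentential form
-- satisfying that iterate is unfolded into a winning strategy by well-founded induction,
-- after annotating each non-terminal with the Kleene level it is evaluated at: expanding
-- a non-terminal of level j + 1 produces symbols of level j only.

open import Defs
open import Data.Fin using (Fin)
open import Data.Bool using (Bool; true)
open import Data.List.Membership.Propositional using (_∈_)
open import Data.Product using (Σ; _,_)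
open import Function.Bundles using (_⇔_)
open import Relation.Binary.PropositionalEquality using (_≡_)

open import Data.Nat using (ℕ; zero; suc; _+_; _*_; _^_; _⊔_; _≤_; _<_; z≤n; _≤′_; ≤′-refl; ≤′-step)
open import Data.Nat.Properties
  using (module ≤-Reasoning; ≤-refl; ≤-trans; ≤⇒≤′; n≤1+n; m≤m+n; m≤n+m; m≤m⊔n; m≤n⊔m; m<n+m; m^n>0;
         +-assoc; +-monoˡ-≤; +-monoʳ-≤; +-monoˡ-<; *-monoˡ-≤)
open import Data.Nat.Induction using (<-wellFounded)
open import Data.Fin using (zero; suc; _≟_)
open import Data.Bool using (false; _∧_; _∨_; if_then_else_)
import Data.Bool.Properties as Bool
open import Data.Vec using (Vec; []; _∷_; tabulate; lookup)
open import Data.Vec.Properties using (lookup∘tabulate; tabulate∘lookup; tabulate-cong)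
import Data.Vec.Properties as Vec
open import Data.List using (List; []; _∷_; map; _++_; length; cartesianProduct; cartesianProductWith; allFin)
open import Data.List.Properties using (∷-injective; ++-identityʳ; map-++; map-∘)
open import Data.List.Membership.Propositional.Properties
  using (∈-cartesianProduct⁺; ∈-cartesianProductWith⁺; ∈-allFin)
open import Data.List.Relation.Unary.Any using (here; there)
open import Data.Maybe using (just)
open import Data.Maybe.Properties using (just-injective)
open import Data.Product using (∃-syntax; _×_; proj₁; proj₂)
open import Data.Sum using (_⊎_; inj₁; inj₂; [_,_]′)
open import Data.Empty using (⊥; ⊥-elim)
open import Function using (_on_)
open import Function.Bundles using (mk⇔)
open import Induction.WellFounded using (WellFounded; Acc; acc)
import Relation.Binary.Construct.On as On
open import Relation.Binary.Definitions using (DecidableEquality)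
open import Relation.Nullary using (yes; no)
open import Relation.Nullary.Decidable using (⌊_⌋)
open import Relation.Binary.PropositionalEquality using (refl; sym; trans; cong; cong₂; subst; module ≡-Reasoning)

bool-ext : ∀ {a b : Bool} → (a ≡ true → b ≡ true) → (b ≡ true → a ≡ true) → a ≡ b
bool-ext {true}          to _    = sym (to refl)
bool-ext {false} {true}  _  from = from refl
bool-ext {false} {false} _  _    = refl

false≢true : false ≡ true → ⊥
false≢true ()

∧-true⁺ : ∀ {a b} → a ≡ true → b ≡ true → a ∧ b ≡ true
∧-true⁺ refl refl = refl

∧-true⁻ : ∀ {a b} → a ∧ b ≡ true → a ≡ true × b ≡ true
∧-true⁻ {true} {true} _ = refl , refl

∨-true⁺ˡ : ∀ {a b} → a ≡ true → a ∨ b ≡ true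
∨-true⁺ˡ refl = refl

∨-true⁺ʳ : ∀ a {b} → b ≡ true → a ∨ b ≡ true
∨-true⁺ʳ a refl = Bool.∨-zeroʳ a

∨-true⁻ : ∀ {a b} → a ∨ b ≡ true → a ≡ true ⊎ b ≡ true
∨-true⁻ {true}  _ = inj₁ refl
∨-true⁻ {false} p = inj₂ p

anyF-true⁺ : ∀ {n} (f : Fin n → Bool) i → f i ≡ true → anyF f ≡ true
anyF-true⁺ f zero    p = ∨-true⁺ˡ p
anyF-true⁺ f (suc i) p = ∨-true⁺ʳ (f zero) (anyF-true⁺ (λ j → f (suc j)) i p)

anyF-true⁻ : ∀ {n} (f : Fin n → Bool) → anyF f ≡ true → ∃[ i ] f i ≡ true
anyF-true⁻ {suc n} f e with ∨-true⁻ e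
... | inj₁ p = zero , p
... | inj₂ p with anyF-true⁻ (λ j → f (suc j)) p
...   | i , q = suc i , q

entry-tabulate : ∀ {n} (f : Fin n → Fin n → Bool) q q' → entry (tabulate λ q → tabulate (f q)) q q' ≡ f q q'
entry-tabulate f q q' = trans (cong (λ row → lookup row q') (lookup∘tabulate _ q)) (lookup∘tabulate (f q) q')

box-ext : ∀ {n} {ρ τ : Box n} → (∀ q q' → entry ρ q q' ≡ entry τ q q') → ρ ≡ τ
box-ext {n} {ρ} {τ} p = begin
    ρ                                      ≡⟨ tabulate-entry ρ ⟨
    tabulate (λ q → tabulate (entry ρ q))  ≡⟨ tabulate-cong (λ q → tabulate-cong (p q)) ⟩
    tabulate (λ q → tabulate (entry τ q))  ≡⟨ tabulate-entry τ ⟩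
    τ                                      ∎
  where
  open ≡-Reasoning
  tabulate-entry : (υ : Box n) → tabulate (λ q → tabulate (entry υ q)) ≡ υ
  tabulate-entry υ = trans (tabulate-cong (λ q → tabulate∘lookup (lookup υ q))) (tabulate∘lookup υ)

⨾ᵇ-true⁺ : ∀ {n} (ρ τ : Box n) {q q' q''} → entry ρ q q' ≡ true → entry τ q' q'' ≡ true →
           entry (ρ ⨾ᵇ τ) q q'' ≡ true
⨾ᵇ-true⁺ ρ τ {q} {q'} {q''} p r = trans (entry-tabulate _ q q'') (anyF-true⁺ _ q' (∧-true⁺ p r))

⨾ᵇ-true⁻ : ∀ {n} (ρ τ : Box n) {q q''} → entry (ρ ⨾ᵇ τ) q q'' ≡ true →
           ∃[ q' ] entry ρ q q' ≡ true × entry τ q' q'' ≡ true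
⨾ᵇ-true⁻ ρ τ {q} {q''} e with anyF-true⁻ _ (trans (sym (entry-tabulate _ q q'')) e)
... | q' , p = q' , ∧-true⁻ p

idᵇ-true⁺ : ∀ {n} (q : Fin n) → entry idᵇ q q ≡ true
idᵇ-true⁺ q with q ≟ q | entry-tabulate (λ q q' → ⌊ q ≟ q' ⌋) q q
... | yes _ | e = e
... | no q≢q | _ = ⊥-elim (q≢q refl)

idᵇ-true⁻ : ∀ {n} {q q' : Fin n} → entry idᵇ q q' ≡ true → q ≡ q'
idᵇ-true⁻ {q = q} {q'} e with q ≟ q' | entry-tabulate (λ q q' → ⌊ q ≟ q' ⌋) q q'
... | yes q≡q' | _ = q≡q'
... | no _     | e' with trans (sym e') e
...   | ()

⨾ᵇ-assoc : ∀ {n} (ρ τ υ : Box n) → (ρ ⨾ᵇ τ) ⨾ᵇ υ ≡ ρ ⨾ᵇ (τ ⨾ᵇ υ)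
⨾ᵇ-assoc ρ τ υ = box-ext λ q r → bool-ext
  (λ e → let j , qj , jr = ⨾ᵇ-true⁻ (ρ ⨾ᵇ τ) υ e
             i , qi , ij = ⨾ᵇ-true⁻ ρ τ qj
         in ⨾ᵇ-true⁺ ρ (τ ⨾ᵇ υ) qi (⨾ᵇ-true⁺ τ υ ij jr))
  (λ e → let i , qi , ir = ⨾ᵇ-true⁻ ρ (τ ⨾ᵇ υ) e
             j , ij , jr = ⨾ᵇ-true⁻ τ υ ir
         in ⨾ᵇ-true⁺ (ρ ⨾ᵇ τ) υ (⨾ᵇ-true⁺ ρ τ qi ij) jr)

⨾ᵇ-identityˡ : ∀ {n} (ρ : Box n) → idᵇ ⨾ᵇ ρ ≡ ρ
⨾ᵇ-identityˡ ρ = box-ext λ q r → bool-ext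
  (λ e → let j , qj , jr = ⨾ᵇ-true⁻ idᵇ ρ e in subst (λ k → entry ρ k r ≡ true) (sym (idᵇ-true⁻ qj)) jr)
  (⨾ᵇ-true⁺ idᵇ ρ (idᵇ-true⁺ q))

⨾ᵇ-identityʳ : ∀ {n} (ρ : Box n) → ρ ⨾ᵇ idᵇ ≡ ρ
⨾ᵇ-identityʳ ρ = box-ext λ q r → bool-ext
  (λ e → let j , qj , jr = ⨾ᵇ-true⁻ ρ idᵇ e in subst (λ k → entry ρ q k ≡ true) (idᵇ-true⁻ jr) qj)
  (λ e → ⨾ᵇ-true⁺ ρ idᵇ e (idᵇ-true⁺ r))

shift : ∀ {n} → Box n → (Box n → Bool) → Box n → Bool
shift ρ ν τ = ν (ρ ⨾ᵇ τ)

shift-id : ∀ {n} (ν : Box n → Bool) τ → shift idᵇ ν τ ≡ ν τ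
shift-id ν τ = cong ν (⨾ᵇ-identityˡ τ)

shift-shift : ∀ {n} (ρ τ : Box n) ν υ → shift τ (shift ρ ν) υ ≡ shift (ρ ⨾ᵇ τ) ν υ
shift-shift ρ τ ν υ = cong ν (sym (⨾ᵇ-assoc ρ τ υ))

eval-cong : ∀ {n} {ν ν' : Box n → Bool} → (∀ ρ → ν ρ ≡ ν' ρ) → ∀ F → eval ν F ≡ eval ν' F
eval-cong p (atom ρ) = p ρ
eval-cong p ff       = refl
eval-cong p (F ∧ᶠ G) = cong₂ _∧_ (eval-cong p F) (eval-cong p G)
eval-cong p (F ∨ᶠ G) = cong₂ _∨_ (eval-cong p F) (eval-cong p G)

eval-mono : ∀ {n} {ν ν' : Box n → Bool} → (∀ ρ → ν ρ ≡ true → ν' ρ ≡ true) →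
            ∀ F → eval ν F ≡ true → eval ν' F ≡ true
eval-mono p (atom ρ) e = p ρ e
eval-mono p (F ∧ᶠ G) e = let eF , eG = ∧-true⁻ e in ∧-true⁺ (eval-mono p F eF) (eval-mono p G eG)
eval-mono p (F ∨ᶠ G) e with ∨-true⁻ e
... | inj₁ eF = ∨-true⁺ˡ (eval-mono p F eF)
... | inj₂ eG = ∨-true⁺ʳ _ (eval-mono p G eG)

eval-⊳ : ∀ {n} (ν : Box n → Bool) ρ G → eval ν (ρ ⊳ G) ≡ eval (shift ρ ν) G
eval-⊳ ν ρ (atom τ) = refl
eval-⊳ ν ρ ff       = refl
eval-⊳ ν ρ (G ∧ᶠ H) = cong₂ _∧_ (eval-⊳ ν ρ G) (eval-⊳ ν ρ H)
eval-⊳ ν ρ (G ∨ᶠ H) = cong₂ _∨_ (eval-⊳ ν ρ G) (eval-⊳ ν ρ H)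

eval-⨾ᶠ : ∀ {n} (ν : Box n → Bool) F G → eval ν (F ⨾ᶠ G) ≡ eval (λ ρ → eval (shift ρ ν) G) F
eval-⨾ᶠ ν (atom ρ) G = eval-⊳ ν ρ G
eval-⨾ᶠ ν ff       G = refl
eval-⨾ᶠ ν (F ∧ᶠ H) G = cong₂ _∧_ (eval-⨾ᶠ ν F G) (eval-⨾ᶠ ν H G)
eval-⨾ᶠ ν (F ∨ᶠ H) G = cong₂ _∨_ (eval-⨾ᶠ ν F G) (eval-⨾ᶠ ν H G)

⨾ᶠ-identityʳ : ∀ {n} (F : BF n) → (F ⨾ᶠ atom idᵇ) ≈ᶠ F
⨾ᶠ-identityʳ F ν = trans (eval-⨾ᶠ ν F (atom idᵇ)) (eval-cong (λ ρ → cong ν (⨾ᵇ-identityʳ ρ)) F)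

⨾ᶠ-congʳ : ∀ {n} (F : BF n) {G G'} → G ≈ᶠ G' → (F ⨾ᶠ G) ≈ᶠ (F ⨾ᶠ G')
⨾ᶠ-congʳ F {G} {G'} G≈G' ν = begin
  eval ν (F ⨾ᶠ G)                          ≡⟨ eval-⨾ᶠ ν F G ⟩
  eval (λ ρ → eval (shift ρ ν) G) F        ≡⟨ eval-cong (λ ρ → G≈G' (shift ρ ν)) F ⟩
  eval (λ ρ → eval (shift ρ ν) G') F       ≡⟨ eval-⨾ᶠ ν F G' ⟨
  eval ν (F ⨾ᶠ G')                         ∎
  where open ≡-Reasoning

⨾ᶠ-mono : ∀ {n} {F F' G G' : BF n} → F ⊑ᶠ F' → G ⊑ᶠ G' → (F ⨾ᶠ G) ⊑ᶠ (F' ⨾ᶠ G')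
⨾ᶠ-mono {F = F} {F'} {G} {G'} F⊑F' G⊑G' ν e =
  subst (_≡ true) (sym (eval-⨾ᶠ ν F' G'))
    (F⊑F' _ (eval-mono (λ ρ → G⊑G' (shift ρ ν)) F (subst (_≡ true) (eval-⨾ᶠ ν F G) e)))

module _ {n} {S : Set} {ν : Box n → Bool} {f : S → BF n} where

  big-refuter⁺ : ∀ {xs x} → x ∈ xs → eval ν (f x) ≡ true → eval ν (big refuter (map f xs)) ≡ true
  big-refuter⁺ {_ ∷ []}     (here refl) e = e
  big-refuter⁺ {_ ∷ _ ∷ _}  (here refl) e = ∨-true⁺ˡ e
  big-refuter⁺ {y ∷ _ ∷ _}  (there x∈)  e = ∨-true⁺ʳ (eval ν (f y)) (big-refuter⁺ x∈ e)

  big-refuter⁻ : ∀ xs → eval ν (big refuter (map f xs)) ≡ true → ∃[ x ] x ∈ xs × eval ν (f x) ≡ true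
  big-refuter⁻ []           ()
  big-refuter⁻ (x ∷ [])     e = x , here refl , e
  big-refuter⁻ (x ∷ y ∷ xs) e =
    [ (λ ex → x , here refl , ex) , (λ ey → ∃-there (big-refuter⁻ (y ∷ xs) ey)) ]′ (∨-true⁻ e)
    where
    ∃-there : ∀ {ys} → ∃[ z ] z ∈ ys × eval ν (f z) ≡ true → ∃[ z ] z ∈ x ∷ ys × eval ν (f z) ≡ true
    ∃-there (z , z∈ , ez) = z , there z∈ , ez

  big-prover⁺ : ∀ {xs x₀} → x₀ ∈ xs → (∀ x → x ∈ xs → eval ν (f x) ≡ true) →
                eval ν (big prover (map f xs)) ≡ true
  big-prover⁺ {x ∷ []}     _ all = all x (here refl)
  big-prover⁺ {x ∷ y ∷ xs} _ all = ∧-true⁺ (all x (here refl)) (big-prover⁺ (here refl) (λ z z∈ → all z (there z∈)))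

  big-prover⁻ : ∀ xs → eval ν (big prover (map f xs)) ≡ true → ∀ x → x ∈ xs → eval ν (f x) ≡ true
  big-prover⁻ (y ∷ [])     e x (here refl) = e
  big-prover⁻ (y ∷ z ∷ xs) e x (here refl) = proj₁ (∧-true⁻ e)
  big-prover⁻ (y ∷ z ∷ xs) e x (there x∈)  = big-prover⁻ (z ∷ xs) (proj₂ (∧-true⁻ {eval ν (f y)} e)) x x∈

big-map-mono : ∀ {n} {S : Set} o {f g : S → BF n} → (∀ x → f x ⊑ᶠ g x) →
               ∀ xs → big o (map f xs) ⊑ᶠ big o (map g xs)
big-map-mono refuter {f} h xs ν e with big-refuter⁻ {f = f} xs e
... | x , x∈ , ex = big-refuter⁺ x∈ (h x ν ex)
big-map-mono prover  h []       ν ()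
big-map-mono prover  {f} h (x ∷ xs) ν e =
  big-prover⁺ (here refl) (λ y y∈ → h y ν (big-prover⁻ {f = f} (x ∷ xs) e y y∈))

-- `form` without its special case for a single symbol; the two agree by form-correct.
seqForm : ∀ {n} {S : Set} → (S → BF n) → List S → BF n
seqForm I []      = atom idᵇ
seqForm I (s ∷ α) = I s ⨾ᶠ seqForm I α

-- The valuation under which a prefix is evaluated when it is followed by γ.
cont : ∀ {n} {S : Set} → (S → BF n) → List S → (Box n → Bool) → Box n → Bool
cont I γ ν ρ = eval (shift ρ ν) (seqForm I γ)

module _ {n} {S : Set} (I : S → BF n) where

  eval-seqForm-++ : ∀ ν α γ → eval ν (seqForm I (α ++ γ)) ≡ eval (cont I γ ν) (seqForm I α)
  eval-seqForm-++ ν []      γ = sym (eval-cong (shift-id ν) (seqForm I γ))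
  eval-seqForm-++ ν (s ∷ α) γ = begin
    eval ν (I s ⨾ᶠ seqForm I (α ++ γ))                               ≡⟨ eval-⨾ᶠ ν (I s) _ ⟩
    eval (λ ρ → eval (shift ρ ν) (seqForm I (α ++ γ))) (I s)         ≡⟨ eval-cong (λ ρ → eval-seqForm-++ (shift ρ ν) α γ) (I s) ⟩
    eval (λ ρ → eval (cont I γ (shift ρ ν)) (seqForm I α)) (I s)     ≡⟨ eval-cong (λ ρ → eval-cong (cont-shift ρ) (seqForm I α)) (I s) ⟩
    eval (λ ρ → eval (shift ρ (cont I γ ν)) (seqForm I α)) (I s)     ≡⟨ eval-⨾ᶠ (cont I γ ν) (I s) _ ⟨
    eval (cont I γ ν) (I s ⨾ᶠ seqForm I α)                           ∎
    where
    open ≡-Reasoning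
    cont-shift : ∀ ρ τ → cont I γ (shift ρ ν) τ ≡ shift ρ (cont I γ ν) τ
    cont-shift ρ τ = eval-cong (shift-shift ρ τ ν) (seqForm I γ)

seqForm-mono : ∀ {n} {S : Set} {I I' : S → BF n} → (∀ s → I s ⊑ᶠ I' s) → ∀ α → seqForm I α ⊑ᶠ seqForm I' α
seqForm-mono h []      ν e = e
seqForm-mono {I = I} {I'} h (s ∷ α) = ⨾ᶠ-mono {F = I s} {I' s} (h s) (seqForm-mono h α)

module _ {A : Set} (g : ℕ → A → Bool) (increasing : ∀ k x → g k x ≡ true → g (suc k) x ≡ true) where

  StableAt : List A → ℕ → Set
  StableAt xs K = ∀ x → x ∈ xs → g (suc K) x ≡ true → g K x ≡ true

  true-persists : ∀ {k k'} x → k ≤′ k' → g k x ≡ true → g k' x ≡ true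
  true-persists x ≤′-refl        e = e
  true-persists x (≤′-step k≤k') e = increasing _ x (true-persists x k≤k' e)

  ∷-stable : ∀ {x xs K} → (g (suc K) x ≡ true → g K x ≡ true) → StableAt xs K → StableAt (x ∷ xs) K
  ∷-stable hx stable _ (here refl) = hx
  ∷-stable hx stable y (there y∈)  = stable y y∈

  -- Each element switches from false to true at most once: stabilise the tail, and if
  -- the head switches right there, stabilise the tail once more beyond that point.
  chain-stabilises : ∀ xs N → ∃[ K ] N ≤ K × StableAt xs K
  chain-stabilises []       N = N , ≤-refl , λ _ ()
  chain-stabilises (x ∷ xs) N with chain-stabilises xs N
  ... | K , N≤K , stable with g (suc K) x in gx
  ...   | false = K , N≤K , ∷-stable (λ e → ⊥-elim (false≢true (trans (sym gx) e))) stable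
  ...   | true  with chain-stabilises xs (suc K)
  ...     | K' , K<K' , stable' =
    K' , ≤-trans N≤K (≤-trans (n≤1+n K) K<K') ,
    ∷-stable (λ _ → true-persists x (≤⇒≤′ K<K') gx) stable'

allVecs : ∀ {A : Set} → List A → ∀ k → List (Vec A k)
allVecs xs zero    = [] ∷ []
allVecs xs (suc k) = cartesianProductWith _∷_ xs (allVecs xs k)

∈-allVecs : ∀ {A : Set} {xs : List A} → (∀ x → x ∈ xs) → ∀ {k} (v : Vec A k) → v ∈ allVecs xs k
∈-allVecs all []      = here refl
∈-allVecs all (x ∷ v) = ∈-cartesianProductWith⁺ _∷_ (all x) (∈-allVecs all v)

bools : List Bool
bools = true ∷ false ∷ []

∈-bools : ∀ b → b ∈ bools
∈-bools true  = here refl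
∈-bools false = there (here refl)

allBoxes : ∀ n → List (Box n)
allBoxes n = allVecs (allVecs bools n) n

∈-allBoxes : ∀ {n} (ρ : Box n) → ρ ∈ allBoxes n
∈-allBoxes = ∈-allVecs (∈-allVecs ∈-bools)

_≟ᵇ_ : ∀ {n} → DecidableEquality (Box n)
_≟ᵇ_ = Vec.≡-dec (Vec.≡-dec Bool._≟_)

update : ∀ {n} → Box n → Bool → (Box n → Bool) → Box n → Bool
update ρ b ν τ = if ⌊ τ ≟ᵇ ρ ⌋ then b else ν τ

-- A valuation only matters through its values on the finitely many boxes, so one
-- representative of each restriction to ρs suffices.
valuationsOn : ∀ {n} → List (Box n) → List (Box n → Bool)
valuationsOn []       = (λ _ → false) ∷ []
valuationsOn (ρ ∷ ρs) = cartesianProductWith (update ρ) bools (valuationsOn ρs)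

∈-valuationsOn : ∀ {n} ρs (ν : Box n → Bool) → ∃[ v ] v ∈ valuationsOn ρs × (∀ ρ → ρ ∈ ρs → ν ρ ≡ v ρ)
∈-valuationsOn []       ν = _ , here refl , λ _ ()
∈-valuationsOn (ρ ∷ ρs) ν with ∈-valuationsOn ρs ν
... | v , v∈ , agree = update ρ (ν ρ) v , ∈-cartesianProductWith⁺ (update ρ) (∈-bools (ν ρ)) v∈ , agree′
  where
  agree′ : ∀ τ → τ ∈ ρ ∷ ρs → ν τ ≡ update ρ (ν ρ) v τ
  agree′ τ τ∈ with τ ≟ᵇ ρ
  agree′ τ _           | yes refl = refl
  agree′ τ (here τ≡ρ)  | no τ≢ρ   = ⊥-elim (τ≢ρ τ≡ρ)
  agree′ τ (there τ∈)  | no _     = agree τ τ∈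

valuations : ∀ n → List (Box n → Bool)
valuations n = valuationsOn (allBoxes n)

∈-valuations : ∀ {n} (ν : Box n → Bool) → ∃[ v ] v ∈ valuations n × (∀ ρ → ν ρ ≡ v ρ)
∈-valuations {n} ν with ∈-valuationsOn (allBoxes n) ν
... | v , v∈ , agree = v , v∈ , λ ρ → agree ρ (∈-allBoxes ρ)

module Semantics (G : Grammar) (A : NFA (Grammar.t G)) where
  open Grammar G
  open NFA A
  open Game G A

  rhsOf-∈⁺ : ∀ {X η} rs → (X , η) ∈ rs → η ∈ rhsOf X rs
  rhsOf-∈⁺ {X} (_ ∷ rs) (here refl) with X ≟ X
  ... | yes _   = here refl
  ... | no X≢X = ⊥-elim (X≢X refl)
  rhsOf-∈⁺ {X} ((Y , _) ∷ rs) (there r) with Y ≟ X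
  ... | yes _ = there (rhsOf-∈⁺ rs r)
  ... | no _  = rhsOf-∈⁺ rs r

  rhsOf-∈⁻ : ∀ {X η} rs → η ∈ rhsOf X rs → (X , η) ∈ rs
  rhsOf-∈⁻ {X} ((Y , _) ∷ rs) η∈ with Y ≟ X
  rhsOf-∈⁻ (_ ∷ rs) (here refl) | yes refl = here refl
  rhsOf-∈⁻ (_ ∷ rs) (there η∈)  | yes _    = there (rhsOf-∈⁻ rs η∈)
  rhsOf-∈⁻ (_ ∷ rs) η∈          | no _     = there (rhsOf-∈⁻ rs η∈)

  owner-cases : ∀ X → owner X ≡ refuter ⊎ owner X ≡ prover
  owner-cases X with owner X
  ... | refuter = inj₁ refl
  ... | prover  = inj₂ refl

  module _ {τ : Fin m → BF n} {X : Fin m} {ν : Box n → Bool} where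

    private
      HoldsAs : Owner → Set
      HoldsAs o = eval ν (big o (map (form τ) (rhsOf X rules))) ≡ true

    Δ-refuter⁺ : owner X ≡ refuter → ∀ {η} → (X , η) ∈ rules → eval ν (form τ η) ≡ true →
                 eval ν (Δ τ X) ≡ true
    Δ-refuter⁺ own r e = subst HoldsAs (sym own) (big-refuter⁺ (rhsOf-∈⁺ rules r) e)

    Δ-refuter⁻ : owner X ≡ refuter → eval ν (Δ τ X) ≡ true →
                 ∃[ η ] (X , η) ∈ rules × eval ν (form τ η) ≡ true
    Δ-refuter⁻ own e with big-refuter⁻ (rhsOf X rules) (subst HoldsAs own e)
    ... | η , η∈ , eη = η , rhsOf-∈⁻ rules η∈ , eη

    -- Needs a rule for X: `big` of the empty list is ff, not the empty conjunction.
    Δ-prover⁺ : owner X ≡ prover → ∀ {η₀} → (X , η₀) ∈ rules →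
                (∀ η → (X , η) ∈ rules → eval ν (form τ η) ≡ true) → eval ν (Δ τ X) ≡ true
    Δ-prover⁺ own r₀ all =
      subst HoldsAs (sym own) (big-prover⁺ (rhsOf-∈⁺ rules r₀) (λ η η∈ → all η (rhsOf-∈⁻ rules η∈)))

    Δ-prover⁻ : owner X ≡ prover → eval ν (Δ τ X) ≡ true →
                ∀ η → (X , η) ∈ rules → eval ν (form τ η) ≡ true
    Δ-prover⁻ own e η r = big-prover⁻ (rhsOf X rules) (subst HoldsAs own e) η (rhsOf-∈⁺ rules r)

  module Prefix {S : Set} (I : S → BF n) (term : Fin t → S) (I-term : ∀ a → I (term a) ≡ atom (letterBox a)) where

    around : List (Fin t) → List S → (Box n → Bool) → Box n → Bool
    around w γ ν = cont I γ (shift (wordBox w) ν)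

    eval-terms : ∀ ν w δ → eval ν (seqForm I (map term w ++ δ)) ≡ eval (shift (wordBox w) ν) (seqForm I δ)
    eval-terms ν []      δ = sym (eval-cong (shift-id ν) (seqForm I δ))
    eval-terms ν (a ∷ w) δ = begin
      eval ν (I (term a) ⨾ᶠ seqForm I (map term w ++ δ))                ≡⟨ cong (λ F → eval ν (F ⨾ᶠ seqForm I (map term w ++ δ))) (I-term a) ⟩
      eval ν (letterBox a ⊳ seqForm I (map term w ++ δ))                ≡⟨ eval-⊳ ν (letterBox a) (seqForm I (map term w ++ δ)) ⟩
      eval (shift (letterBox a) ν) (seqForm I (map term w ++ δ))         ≡⟨ eval-terms _ w δ ⟩
      eval (shift (wordBox w) (shift (letterBox a) ν)) (seqForm I δ)     ≡⟨ eval-cong (shift-shift (letterBox a) (wordBox w) ν) (seqForm I δ) ⟩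
      eval (shift (wordBox (a ∷ w)) ν) (seqForm I δ)                     ∎
      where open ≡-Reasoning

    eval-word : ∀ ν w → eval ν (seqForm I (map term w)) ≡ ν (wordBox w)
    eval-word ν w = begin
      eval ν (seqForm I (map term w))         ≡⟨ cong (λ α → eval ν (seqForm I α)) (++-identityʳ (map term w)) ⟨
      eval ν (seqForm I (map term w ++ []))   ≡⟨ eval-terms ν w [] ⟩
      ν (wordBox w ⨾ᵇ idᵇ)                    ≡⟨ cong ν (⨾ᵇ-identityʳ (wordBox w)) ⟩
      ν (wordBox w)                           ∎
      where open ≡-Reasoning

    eval-at : ∀ ν w s γ → eval ν (seqForm I (map term w ++ s ∷ γ)) ≡ eval (around w γ ν) (I s)
    eval-at ν w s γ = trans (eval-terms ν w (s ∷ γ)) (eval-⨾ᶠ _ (I s) (seqForm I γ))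

    eval-split : ∀ ν w β γ → eval ν (seqForm I (map term w ++ β ++ γ)) ≡ eval (around w γ ν) (seqForm I β)
    eval-split ν w β γ = trans (eval-terms ν w (β ++ γ)) (eval-seqForm-++ I _ β γ)

  ⟦_⟧ : (Fin m → BF n) → SF → BF n
  ⟦ τ ⟧ = seqForm (symForm τ)

  form-correct : ∀ τ α → form τ α ≈ᶠ ⟦ τ ⟧ α
  form-correct τ []           ν = refl
  form-correct τ (s ∷ [])     ν = sym (⨾ᶠ-identityʳ (symForm τ s) ν)
  form-correct τ (s ∷ s' ∷ α)   = ⨾ᶠ-congʳ (symForm τ s) (form-correct τ (s' ∷ α))

  ⟦⟧-mono : ∀ {τ τ'} → (∀ X → τ X ⊑ᶠ τ' X) → ∀ α → ⟦ τ ⟧ α ⊑ᶠ ⟦ τ' ⟧ α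
  ⟦⟧-mono τ⊑τ' = seqForm-mono λ { (nt X) → τ⊑τ' X ; (tm a) ν e → e }

  form-mono : ∀ {τ τ'} → (∀ X → τ X ⊑ᶠ τ' X) → ∀ η → form τ η ⊑ᶠ form τ' η
  form-mono {τ} {τ'} τ⊑τ' η ν e =
    subst (_≡ true) (sym (form-correct τ' η ν)) (⟦⟧-mono τ⊑τ' η ν (subst (_≡ true) (form-correct τ η ν) e))

  Δ-mono : ∀ {τ τ'} → (∀ X → τ X ⊑ᶠ τ' X) → ∀ X → Δ τ X ⊑ᶠ Δ τ' X
  Δ-mono τ⊑τ' X = big-map-mono (owner X) (form-mono τ⊑τ') (rhsOf X rules)

  kleene : ℕ → Fin m → BF n
  kleene zero    X = ff
  kleene (suc k) X = Δ (kleene k) X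

  kleene-increasing : ∀ k X → kleene k X ⊑ᶠ kleene (suc k) X
  kleene-increasing zero    X ν ()
  kleene-increasing (suc k) X   = Δ-mono (kleene-increasing k) X

  kleene-stabilises : ∃[ K ] IsSolution (kleene K)
  kleene-stabilises =
    let K , _ , stable = chain-stabilises holds increasing points 0
    in K , λ X ν → bool-ext (kleene-increasing K X ν) (stable-everywhere {K} stable X ν)
    where
    holds : ℕ → Fin m × (Box n → Bool) → Bool
    holds k (X , v) = eval v (kleene k X)

    increasing : ∀ k x → holds k x ≡ true → holds (suc k) x ≡ true
    increasing k (X , v) = kleene-increasing k X v

    points : List (Fin m × (Box n → Bool))
    points = cartesianProduct (allFin m) (valuations n)

    stable-everywhere : ∀ {K} → StableAt holds increasing points K →
                        ∀ X ν → eval ν (kleene (suc K) X) ≡ true → eval ν (kleene K X) ≡ true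
    stable-everywhere {K} stable X ν e with ∈-valuations ν
    ... | v , v∈ , agree =
      subst (_≡ true) (sym (eval-cong agree (kleene K X)))
        (stable (X , v) (∈-cartesianProduct⁺ (∈-allFin X) v∈) (subst (_≡ true) (eval-cong agree (kleene (suc K) X)) e))

  leftmost-node : ∀ w X γ → leftmost (map tm w ++ nt X ∷ γ) ≡ just X
  leftmost-node []      X γ = refl
  leftmost-node (a ∷ w) X γ = leftmost-node w X γ

  leftmost-split : ∀ α {X} → leftmost α ≡ just X → ∃[ w ] ∃[ γ ] α ≡ map tm w ++ nt X ∷ γ
  leftmost-split (nt Y ∷ α) refl = [] , α , refl
  leftmost-split (tm a ∷ α) e with leftmost-split α e
  ... | w , γ , refl = a ∷ w , γ , refl

  node-injective : ∀ (w w' : List (Fin t)) {X X' : Fin m} {γ γ' : SF} → map tm w ++ nt X ∷ γ ≡ map tm w' ++ nt X' ∷ γ' →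
                   w ≡ w' × X ≡ X' × γ ≡ γ'
  node-injective []      []       refl = refl , refl , refl
  node-injective []      (_ ∷ _)  ()
  node-injective (_ ∷ _) []       ()
  node-injective (a ∷ w) (b ∷ w') eq with ∷-injective eq
  ... | refl , eq' with node-injective w w' eq'
  ...   | refl , refl , refl = refl , refl , refl

  step-inversion : ∀ {α β w X γ} → α ⇒L β → α ≡ map tm w ++ nt X ∷ γ →
                   ∃[ η ] (X , η) ∈ rules × β ≡ map tm w ++ η ++ γ
  step-inversion {w = w} (step w' X' η γ' r) eq with node-injective w' w eq
  ... | refl , refl , refl = η , r , refl

  module _ {ν : Box n → Bool} where

    InP-mono : ∀ {i k α} → i ≤ k → InP ν i α → InP ν k α
    InP-mono i≤k = go (≤⇒≤′ i≤k)
      where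
      go : ∀ {i k α} → i ≤′ k → InP ν i α → InP ν k α
      go ≤′-refl        p = p
      go (≤′-step i≤′k) p = inj₁ (go i≤′k p)

    common-index : ∀ {B : Set} (f : B → SF) xs → (∀ x → x ∈ xs → TreeValue ν (f x)) →
                   ∃[ i ] ∀ x → x ∈ xs → InP ν i (f x)
    common-index f []       _  = 0 , λ _ ()
    common-index f (x ∷ xs) tv with tv x (here refl) | common-index f xs (λ y y∈ → tv y (there y∈))
    ... | i , p | k , ps = i ⊔ k , λ where
      _ (here refl) → InP-mono (m≤m⊔n i k) p
      y (there y∈)  → InP-mono (m≤n⊔m i k) (ps y y∈)

    TreeValue-refuter : ∀ {w X η γ} → owner X ≡ refuter → (X , η) ∈ rules →
                        TreeValue ν (map tm w ++ η ++ γ) → TreeValue ν (map tm w ++ nt X ∷ γ)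
    TreeValue-refuter {w} {X} {η} {γ} own r (i , p) =
      suc i , inj₂ (inj₁ ((X , leftmost-node w X γ , own) , _ , step w X η γ r , p))

    TreeValue-prover : ∀ {w X γ} → owner X ≡ prover →
                       (∀ η → (X , η) ∈ rules → TreeValue ν (map tm w ++ η ++ γ)) →
                       TreeValue ν (map tm w ++ nt X ∷ γ)
    TreeValue-prover {w} {X} {γ} own children
      with common-index (λ η → map tm w ++ η ++ γ) (rhsOf X rules) (λ η η∈ → children η (rhsOf-∈⁻ rules η∈))
    ... | i , ps = suc i , inj₂ (inj₂ ((X , leftmost-node w X γ , own) , child))
      where
      child : ∀ β → (map tm w ++ nt X ∷ γ) ⇒L β → InP ν i β
      child β d with step-inversion d refl
      ... | η , r , refl = ps η (rhsOf-∈⁺ rules r)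

  module Soundness (hasRule : ∀ X → Σ SF λ η → (X , η) ∈ rules)
                   (σ : Fin m → BF n) (σ-solution : IsSolution σ) (ν : Box n → Bool) where
    open Prefix (symForm σ) tm (λ _ → refl)

    node-true : ∀ w X γ → eval (around w γ ν) (Δ σ X) ≡ true → eval ν (⟦ σ ⟧ (map tm w ++ nt X ∷ γ)) ≡ true
    node-true w X γ e = trans (eval-at ν w (nt X) γ) (trans (σ-solution X _) e)

    child-true : ∀ w η γ → eval ν (⟦ σ ⟧ (map tm w ++ η ++ γ)) ≡ true → eval (around w γ ν) (form σ η) ≡ true
    child-true w η γ e = trans (form-correct σ η _) (trans (sym (eval-split ν w η γ)) e)

    sound : ∀ i α → InP ν i α → eval ν (⟦ σ ⟧ α) ≡ true
    sound zero    _ (w , refl , e) = trans (eval-word ν w) e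
    sound (suc i) α (inj₁ p)       = sound i α p
    sound (suc i) _ (inj₂ (inj₁ ((Y , lm , own) , _ , step w X η γ r , p))) =
      node-true w X γ (Δ-refuter⁺ own′ r (child-true w η γ (sound i _ p)))
      where
      own′ : owner X ≡ refuter
      own′ = subst (λ Z → owner Z ≡ refuter) (just-injective (trans (sym lm) (leftmost-node w X γ))) own
    sound (suc i) α (inj₂ (inj₂ ((X , lm , own) , children))) with leftmost-split α lm
    ... | w , γ , refl = node-true w X γ (Δ-prover⁺ own (proj₂ (hasRule X))
                           λ η r → child-true w η γ (sound i _ (children _ (step w X η γ r))))

  -- A non-terminal annotated with level j stands for the j-th Kleene approximant of its equation.
  data LSym : Set where
    ltm : Fin t → LSym
    lnt : Fin m → ℕ → LSym

  levelForm : LSym → BF n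
  levelForm (ltm a)   = atom (letterBox a)
  levelForm (lnt X j) = kleene j X

  eraseSym : LSym → Sym m t
  eraseSym (ltm a)   = tm a
  eraseSym (lnt X _) = nt X

  erase : List LSym → SF
  erase = map eraseSym

  atLevel : ℕ → SF → List LSym
  atLevel j []           = []
  atLevel j (tm a ∷ α)   = ltm a ∷ atLevel j α
  atLevel j (nt X ∷ α)   = lnt X j ∷ atLevel j α

  erase-atLevel : ∀ j α → erase (atLevel j α) ≡ α
  erase-atLevel j []         = refl
  erase-atLevel j (tm a ∷ α) = cong (tm a ∷_) (erase-atLevel j α)
  erase-atLevel j (nt X ∷ α) = cong (nt X ∷_) (erase-atLevel j α)

  seqForm-atLevel : ∀ j α → seqForm levelForm (atLevel j α) ≡ ⟦ kleene j ⟧ α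
  seqForm-atLevel j []         = refl
  seqForm-atLevel j (tm a ∷ α) = cong (atom (letterBox a) ⨾ᶠ_) (seqForm-atLevel j α)
  seqForm-atLevel j (nt X ∷ α) = cong (kleene j X ⨾ᶠ_) (seqForm-atLevel j α)

  erase-terms : ∀ w δ → erase (map ltm w ++ δ) ≡ map tm w ++ erase δ
  erase-terms w δ = trans (map-++ eraseSym (map ltm w) δ) (cong (_++ erase δ) (sym (map-∘ w)))

  erase-expansion : ∀ w j η γ → erase (map ltm w ++ atLevel j η ++ γ) ≡ map tm w ++ η ++ erase γ
  erase-expansion w j η γ = begin
    erase (map ltm w ++ atLevel j η ++ γ)        ≡⟨ erase-terms w _ ⟩
    map tm w ++ erase (atLevel j η ++ γ)          ≡⟨ cong (map tm w ++_) (map-++ eraseSym (atLevel j η) γ) ⟩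
    map tm w ++ erase (atLevel j η) ++ erase γ    ≡⟨ cong (λ β → map tm w ++ β ++ erase γ) (erase-atLevel j η) ⟩
    map tm w ++ η ++ erase γ                      ∎
    where open ≡-Reasoning

  totalLength : List (Fin m × SF) → ℕ
  totalLength []             = 0
  totalLength ((_ , η) ∷ rs) = length η + totalLength rs

  length-≤-totalLength : ∀ {X η} rs → (X , η) ∈ rs → length η ≤ totalLength rs
  length-≤-totalLength (_ ∷ rs) (here refl) = m≤m+n _ _
  length-≤-totalLength ((_ , η′) ∷ rs) (there r) = ≤-trans (length-≤-totalLength rs r) (m≤n+m _ (length η′))

  base : ℕ
  base = suc (totalLength rules)

  -- A non-terminal of level j weighs base ^ j; expanding it yields fewer than base
  -- symbols of level j - 1, so every expansion step lowers the weight.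
  weight : List LSym → ℕ
  weight []            = 0
  weight (ltm _ ∷ α)   = weight α
  weight (lnt _ j ∷ α) = base ^ j + weight α

  weight-terms : ∀ w δ → weight (map ltm w ++ δ) ≡ weight δ
  weight-terms []      δ = refl
  weight-terms (_ ∷ w) δ = weight-terms w δ

  weight-++ : ∀ α γ → weight (α ++ γ) ≡ weight α + weight γ
  weight-++ []            γ = refl
  weight-++ (ltm _ ∷ α)   γ = weight-++ α γ
  weight-++ (lnt _ j ∷ α) γ = trans (cong (base ^ j +_) (weight-++ α γ)) (sym (+-assoc (base ^ j) (weight α) (weight γ)))

  weight-atLevel : ∀ j η → weight (atLevel j η) ≤ length η * base ^ j
  weight-atLevel j []         = z≤n
  weight-atLevel j (tm _ ∷ η) = ≤-trans (weight-atLevel j η) (m≤n+m _ (base ^ j))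
  weight-atLevel j (nt _ ∷ η) = +-monoʳ-≤ (base ^ j) (weight-atLevel j η)

  weight-expansion : ∀ w {X η} j γ → (X , η) ∈ rules →
                     weight (map ltm w ++ atLevel j η ++ γ) < weight (map ltm w ++ lnt X (suc j) ∷ γ)
  weight-expansion w {X} {η} j γ r = begin-strict
    weight (map ltm w ++ atLevel j η ++ γ)       ≡⟨ weight-terms w _ ⟩
    weight (atLevel j η ++ γ)                    ≡⟨ weight-++ (atLevel j η) γ ⟩
    weight (atLevel j η) + weight γ              ≤⟨ +-monoˡ-≤ (weight γ) (weight-atLevel j η) ⟩
    length η * base ^ j + weight γ               ≤⟨ +-monoˡ-≤ (weight γ) (*-monoˡ-≤ (base ^ j) (length-≤-totalLength rules r)) ⟩
    totalLength rules * base ^ j + weight γ      <⟨ +-monoˡ-< (weight γ) (m<n+m _ (m^n>0 base j)) ⟩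
    base ^ suc j + weight γ                      ≡⟨ weight-terms w _ ⟨
    weight (map ltm w ++ lnt X (suc j) ∷ γ)      ∎
    where open ≤-Reasoning

  _⊏_ : List LSym → List LSym → Set
  _⊏_ = _<_ on weight

  ⊏-wellFounded : WellFounded _⊏_
  ⊏-wellFounded = On.wellFounded weight <-wellFounded

  data Shape : List LSym → Set where
    word : ∀ w → Shape (map ltm w)
    node : ∀ w X j γ → Shape (map ltm w ++ lnt X j ∷ γ)

  shape : ∀ α → Shape α
  shape []            = word []
  shape (lnt X j ∷ α) = node [] X j α
  shape (ltm a ∷ α)   with shape α
  ... | word w       = word (a ∷ w)
  ... | node w X j γ = node (a ∷ w) X j γ

  module Completeness (ν : Box n → Bool) where
    open Prefix levelForm ltm (λ _ → refl)

    complete : ∀ α → Acc _⊏_ α → eval ν (seqForm levelForm α) ≡ true → TreeValue ν (erase α)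
    complete α (acc smaller) e with shape α
    ... | word w = 0 , w , sym (map-∘ w) , trans (sym (eval-word ν w)) e
    ... | node w X zero γ = ⊥-elim (false≢true (trans (sym (eval-at ν w (lnt X zero) γ)) e))
    ... | node w X (suc j) γ =
      subst (TreeValue ν) (sym (erase-terms w _)) (expand (trans (sym (eval-at ν w (lnt X (suc j)) γ)) e))
      where
      child : ∀ {η} → (X , η) ∈ rules → eval (around w γ ν) (form (kleene j) η) ≡ true →
              TreeValue ν (map tm w ++ η ++ erase γ)
      child {η} r eη = subst (TreeValue ν) (erase-expansion w j η γ)
        (complete _ (smaller (weight-expansion w j γ r)) (begin
          eval ν (seqForm levelForm (map ltm w ++ atLevel j η ++ γ))  ≡⟨ eval-split ν w (atLevel j η) γ ⟩
          eval (around w γ ν) (seqForm levelForm (atLevel j η))       ≡⟨ cong (eval (around w γ ν)) (seqForm-atLevel j η) ⟩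
          eval (around w γ ν) (⟦ kleene j ⟧ η)                         ≡⟨ form-correct (kleene j) η _ ⟨
          eval (around w γ ν) (form (kleene j) η)                      ≡⟨ eη ⟩
          true                                                          ∎))
        where open ≡-Reasoning

      expand : eval (around w γ ν) (Δ (kleene j) X) ≡ true → TreeValue ν (map tm w ++ nt X ∷ erase γ)
      expand eΔ with owner-cases X
      ... | inj₁ own = let η , r , eη = Δ-refuter⁻ own eΔ in TreeValue-refuter own r (child r eη)
      ... | inj₂ own = TreeValue-prover own λ η r → child r (Δ-prover⁻ own eΔ η r)

    complete-at-level : ∀ j α → eval ν (⟦ kleene j ⟧ α) ≡ true → TreeValue ν α
    complete-at-level j α e =
      subst (TreeValue ν) (erase-atLevel j α)
        (complete (atLevel j α) (⊏-wellFounded _) (trans (cong (eval ν) (seqForm-atLevel j α)) e))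

theorem15 : (G : Grammar) (A : NFA (Grammar.t G)) →
    (∀ X → Σ (Game.SF G A) λ η → (X , η) ∈ Grammar.rules G) →
    (σ : Fin (Grammar.m G) → BF (NFA.n A)) → Game.IsLeastSolution G A σ →
    (α : Game.SF G A) (ν : Box (NFA.n A) → Bool) →
    Game.TreeValue G A ν α ⇔ (eval ν (Game.form G A σ α) ≡ true)
theorem15 G A hasRule σ (σ-solution , σ-least) α ν = mk⇔ tree⇒formula formula⇒tree
  where
  open Semantics G A

  tree⇒formula : Game.TreeValue G A ν α → eval ν (Game.form G A σ α) ≡ true
  tree⇒formula (i , p) = trans (form-correct σ α ν) (Soundness.sound hasRule σ σ-solution ν i α p)

  formula⇒tree : eval ν (Game.form G A σ α) ≡ true → Game.TreeValue G A ν α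
  formula⇒tree e with kleene-stabilises
  ... | K , kleene-solution =
    Completeness.complete-at-level ν K α
      (⟦⟧-mono (σ-least (kleene K) kleene-solution) α ν (trans (sym (form-correct σ α ν)) e))
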